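{- For every positive integer $k$: $\gamma_k(C_{3k})=3$, $\gamma_{k+1}(C_{3k+1})=\binom{k+2}{2}+2\binom{k}{2}+3k$, and $\gamma_{k+1}(C_{3k+2})=3k+2$.
   Context: For a graph $G$, a set $D$ of vertices is dominating if every vertex not in $D$ is adjacent to some vertex of $D$; $\gamma_k(G)$ is the number of dominating sets of cardinality exactly $k$. $C_n$ is the cycle with $n$ vertices (for $n\ge 3$). Binomial coefficients $\binom{a}{b}$ are $0$ when $b>a$. -}

module Defs where

open import Data.Nat using (ℕ; zero; suc; _+_; _%_)
open import Data.Nat.Properties using (_≟_)
open import Data.Bool using (Bool; true; false)
open import Data.Fin using (Fin; toℕ)
open import Data.Fin.Properties using (all?; any?)
open import Data.Fin.Subset using (Subset; _∈_; _∉_; ∣_∣)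
open import Data.Fin.Subset.Properties using (_∈?_)
open import Data.Vec using (Vec; []; _∷_)
open import Data.List using (List; []; _∷_; map; _++_; length; filter)
open import Data.Product using (_×_; _,_; ∃)
open import Data.Sum using (_⊎_)
open import Relation.Nullary using (Dec; ¬_)
open import Relation.Nullary.Decidable using (_⊎-dec_; _×-dec_; _→-dec_; ¬?)
open import Relation.Binary.PropositionalEquality using (_≡_)

record Graph (n : ℕ) : Set₁ where
  field
    Adj  : Fin n → Fin n → Set
    adj? : (u v : Fin n) → Dec (Adj u v)
open Graph public

Dominating : ∀ {n} → Graph n → Subset n → Set
Dominating {n} G D = (v : Fin n) → v ∉ D → ∃ λ u → u ∈ D × Adj G u v

dominating? : ∀ {n} (G : Graph n) (D : Subset n) → Dec (Dominating G D)
dominating? G D = all? λ v → ¬? (v ∈? D) →-dec any? λ u → (u ∈? D) ×-dec adj? G u v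

allSubsets : (n : ℕ) → List (Subset n)
allSubsets zero    = [] ∷ []
allSubsets (suc n) = map (true ∷_) (allSubsets n) ++ map (false ∷_) (allSubsets n)

γ : ∀ {n} → Graph n → ℕ → ℕ
γ {n} G k = length (filter (λ D → (∣ D ∣ ≟ k) ×-dec dominating? G D) (allSubsets n))

CycleAdj : (m : ℕ) → Fin (3 + m) → Fin (3 + m) → Set
CycleAdj m i j = (toℕ j ≡ (suc (toℕ i)) % (3 + m)) ⊎ (toℕ i ≡ (suc (toℕ j)) % (3 + m))

Cycle : (m : ℕ) → Graph (3 + m)
Cycle m = record
  { Adj  = CycleAdj m
  ; adj? = λ i j → (toℕ j ≟ (suc (toℕ i)) % (3 + m)) ⊎-dec (toℕ i ≟ (suc (toℕ j)) % (3 + m))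
  }

module Submission where

-- A set D of vertices of C_n dominates iff no three cyclically consecutive vertices lie outside D,
-- i.e. the bit word of D, read cyclically, has no three consecutive zeros. Fixing the first two bits
-- turns this into a linear condition on the remaining n - 2 bits: the word must be accepted by the
-- three-state automaton counting the current run of zeros, with a bound on the final run that
-- depends on the two fixed bits. A member covers at most three places, so a dominating k-set needs
-- n ≤ 3k, and the slack δ = 3k - n is 0, 2 and 1 for C_{3k}, C_{3k+1} (with k + 1 members) and
-- C_{3k+2}. Counting accepted words by slack, δ = 0 leaves a unique word, δ = 1 linearly many and
-- δ = 2 quadratically many, which assemble into the three formulas.

open import Data.Bool using (Bool; true; false; _∧_; _∨_; if_then_else_; T)
open import Data.Bool.Properties using (∧-zeroʳ; T-∧; T-∨; T-≡)
open import Data.Empty using (⊥-elim)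
open import Data.Fin using (Fin; zero; suc; toℕ; fromℕ<; fromℕ; inject₁)
open import Data.Fin.Properties
  using (toℕ-fromℕ<; fromℕ<-cong; fromℕ<-toℕ; toℕ-injective; toℕ<n; toℕ-fromℕ; toℕ-inject₁)
open import Data.Fin.Subset using (Subset; ∣_∣; _∈_)
open import Data.Fin.Subset.Properties using (_∈?_)
open import Data.List using (List; []; _∷_; _++_; length; filter; map; replicate)
open import Data.List.Properties using (length-++; filter-++)
open import Data.Nat using (ℕ; zero; suc; _+_; _*_; _≡ᵇ_; _≤ᵇ_; _<_; _≤_; z≤n; s≤s; s≤s⁻¹; s<s⁻¹)
open import Data.Nat.Combinatorics using (_C_; nCk+nC[k+1]≡[n+1]C[k+1]; nC1≡n)
open import Data.Nat.DivMod using (_%_; m%n<n; m<n⇒m%n≡m; n%n≡0; [m+n]%n≡m%n; %-distribˡ-+; m%n%n≡m%n)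
open import Data.Nat.Properties
  using ( _≟_; _<?_; ≤ᵇ-reflects-≤; suc-injective; +-comm; +-identityʳ; +-suc; +-cancelˡ-≡
        ; ≤-refl; ≤-reflexive; ≤-trans; <⇒≤; <⇒≱; ≮⇒≥; n≤1+n; m≤m+n; m≤n+m; +-monoˡ-≤; +-monoʳ-≤
        ; m≤n⇒m<n∨m≡n )
open import Data.Nat.Tactic.RingSolver using (solve-∀)
open import Data.Product using (_×_; _,_; proj₁; proj₂; ∃)
open import Data.Sum using (_⊎_; inj₁; inj₂; map₂)
open import Data.Vec using (Vec; []; _∷_; toList; lookup)
open import Data.Vec.Properties using (length-toList; []=⇒lookup; lookup⇒[]=)
open import Function using (_∘_)
open import Function.Bundles using (Equivalence; _⇔_; mk⇔)
open import Relation.Binary.PropositionalEquality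
open import Relation.Nullary using (Dec; does; yes; no)
open import Relation.Nullary.Decidable using (_×-dec_)
open import Relation.Nullary.Reflects using (ofʸ; ofⁿ; det; fromEquivalence)
open import Relation.Unary using (Pred; Decidable)

open import Defs

count : ∀ n → (Vec Bool n → Bool) → ℕ
count zero    f = if f [] then 1 else 0
count (suc n) f = count n (f ∘ (true ∷_)) + count n (f ∘ (false ∷_))

count-cong : ∀ n {f g : Vec Bool n → Bool} → (∀ v → f v ≡ g v) → count n f ≡ count n g
count-cong zero    f≗g rewrite f≗g [] = refl
count-cong (suc n) f≗g = cong₂ _+_ (count-cong n (f≗g ∘ (true ∷_))) (count-cong n (f≗g ∘ (false ∷_)))

count-none : ∀ n {f : Vec Bool n → Bool} → (∀ v → f v ≡ false) → count n f ≡ 0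
count-none zero    f≗false rewrite f≗false [] = refl
count-none (suc n) f≗false =
  cong₂ _+_ (count-none n (f≗false ∘ (true ∷_))) (count-none n (f≗false ∘ (false ∷_)))

count-∧-false : ∀ n (f : Vec Bool n → Bool) → count n (λ r → f r ∧ false) ≡ 0
count-∧-false n f = count-none n (∧-zeroʳ ∘ f)

length-filter-map : ∀ {A B : Set} {ℓ} {P : Pred B ℓ} (P? : Decidable P) (g : A → B) (xs : List A) →
                    length (filter P? (map g xs)) ≡ length (filter (P? ∘ g) xs)
length-filter-map P? g []       = refl
length-filter-map P? g (x ∷ xs) with does (P? (g x))
... | true  = cong suc (length-filter-map P? g xs)
... | false = length-filter-map P? g xs

length-filter-allSubsets : ∀ n {ℓ} {P : Pred (Subset n) ℓ} (P? : Decidable P) →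
                           length (filter P? (allSubsets n)) ≡ count n (does ∘ P?)
length-filter-allSubsets zero    P? with does (P? [])
... | true  = refl
... | false = refl
length-filter-allSubsets (suc n) P? = begin
    length (filter P? (map (true ∷_) S ++ map (false ∷_) S))
  ≡⟨ cong length (filter-++ P? (map (true ∷_) S) _) ⟩
    length (filter P? (map (true ∷_) S) ++ filter P? (map (false ∷_) S))
  ≡⟨ length-++ (filter P? (map (true ∷_) S)) ⟩
    length (filter P? (map (true ∷_) S)) + length (filter P? (map (false ∷_) S))
  ≡⟨ cong₂ _+_ (trans (length-filter-map P? (true ∷_) S) (length-filter-allSubsets n (P? ∘ (true ∷_))))
               (trans (length-filter-map P? (false ∷_) S) (length-filter-allSubsets n (P? ∘ (false ∷_)))) ⟩
    count (suc n) (does ∘ P?) ∎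
  where
  open ≡-Reasoning
  S = allSubsets n

≤ᵇ-true : ∀ {a c} → a ≤ c → (a ≤ᵇ c) ≡ true
≤ᵇ-true {a} {c} a≤c = det (≤ᵇ-reflects-≤ a c) (ofʸ a≤c)

≤ᵇ-false : ∀ {a c} → c < a → (a ≤ᵇ c) ≡ false
≤ᵇ-false {a} {c} c<a = det (≤ᵇ-reflects-≤ a c) (ofⁿ (<⇒≱ c<a))

-- The length of the run of non-members just read; a third consecutive one is rejected.
data Gap : Set where
  g0 g1 g2 : Gap

gap : Gap → ℕ
gap g0 = 0
gap g1 = 1
gap g2 = 2

run : Gap → List Bool → Bool
run _  []          = true
run _  (true ∷ w)  = run g0 w
run g0 (false ∷ w) = run g1 w
run g1 (false ∷ w) = run g2 w
run g2 (false ∷ w) = false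

runWithin : ℕ → Gap → ∀ {n} → Vec Bool n → Bool
runWithin c s  []          = gap s ≤ᵇ c
runWithin c _  (true ∷ r)  = runWithin c g0 r
runWithin c g0 (false ∷ r) = runWithin c g1 r
runWithin c g1 (false ∷ r) = runWithin c g2 r
runWithin c g2 (false ∷ r) = false

Tolerates : List Bool → ℕ → Set
Tolerates t c = ∀ s → run s t ≡ (gap s ≤ᵇ c)

run-++-tolerant : ∀ {t c} → Tolerates t c → ∀ s {n} (r : Vec Bool n) → run s (toList r ++ t) ≡ runWithin c s r
run-++-tolerant tol s  []          = tol s
run-++-tolerant tol _  (true ∷ r)  = run-++-tolerant tol g0 r
run-++-tolerant tol g0 (false ∷ r) = run-++-tolerant tol g1 r
run-++-tolerant tol g1 (false ∷ r) = run-++-tolerant tol g2 r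
run-++-tolerant tol g2 (false ∷ r) = refl

words : ℕ → Gap → ℕ → ℕ → ℕ
words c s m k = count m (λ r → (∣ r ∣ ≡ᵇ k) ∧ runWithin c s r)

words-overlong : ∀ c s m k → k * 3 + c < gap s + m → words c s m k ≡ 0
words-overlong c s  zero    zero    h rewrite ≤ᵇ-false (subst (c <_) (+-identityʳ (gap s)) h) = refl
words-overlong c s  zero    (suc k) h = refl
words-overlong c g0 (suc m) zero    h = cong₂ _+_ (count-none m (λ _ → refl)) (words-overlong c g1 m zero h)
words-overlong c g1 (suc m) zero    h = cong₂ _+_ (count-none m (λ _ → refl)) (words-overlong c g2 m zero h)
words-overlong c g2 (suc m) zero    h = cong₂ _+_ (count-none m (λ _ → refl)) (count-∧-false m _)
words-overlong c g0 (suc m) (suc k) (s≤s h) =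
  cong₂ _+_ (words-overlong c g0 m k (<⇒≤ (<⇒≤ h))) (words-overlong c g1 m (suc k) (s≤s h))
words-overlong c g1 (suc m) (suc k) (s≤s (s≤s h)) =
  cong₂ _+_ (words-overlong c g0 m k (<⇒≤ h)) (words-overlong c g2 m (suc k) (s≤s (s≤s h)))
words-overlong c g2 (suc m) (suc k) (s≤s (s≤s (s≤s h))) =
  cong₂ _+_ (words-overlong c g0 m k h) (count-∧-false m _)

words-noOnes : ∀ c s m → c ≤ 2 → gap s + m ≤ c → words c s m 0 ≡ 1
words-noOnes c s  zero    c≤2 h rewrite ≤ᵇ-true (subst (_≤ c) (+-identityʳ (gap s)) h) = refl
words-noOnes c g0 (suc m) c≤2 h = cong₂ _+_ (count-none m (λ _ → refl)) (words-noOnes c g1 m c≤2 h)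
words-noOnes c g1 (suc m) c≤2 h = cong₂ _+_ (count-none m (λ _ → refl)) (words-noOnes c g2 m c≤2 h)
words-noOnes c g2 (suc m) c≤2 h = ⊥-elim (<⇒≱ (s≤s (s≤s (s≤s z≤n))) (≤-trans h c≤2))

-- ways c s δ k is words c s m k expressed through the slack δ = 3k + c - (gap s + m): every member
-- ends a run of at most two non-members, so a member read in state s uses up 2 - gap s of the slack.
ways₀ ways₁ ways₂ : (c δ k : ℕ) → ℕ
ways₀ c δ             zero    = if δ ≤ᵇ c then 1 else 0
ways₀ c (suc (suc δ)) (suc k) = ways₀ c δ k + ways₁ c (suc (suc δ)) (suc k)
ways₀ c δ             (suc k) = ways₁ c δ (suc k)
ways₁ c δ             zero    = if suc δ ≤ᵇ c then 1 else 0
ways₁ c (suc δ)       (suc k) = ways₀ c δ k + ways₂ c (suc δ) (suc k)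
ways₁ c zero          (suc k) = ways₂ c zero (suc k)
ways₂ c δ             zero    = if suc (suc δ) ≤ᵇ c then 1 else 0
ways₂ c δ             (suc k) = ways₀ c δ k

ways : ℕ → Gap → ℕ → ℕ → ℕ
ways c g0 = ways₀ c
ways c g1 = ways₁ c
ways c g2 = ways₂ c

ways-noOnes : ∀ c s δ → gap s + δ ≤ c → ways c s δ 0 ≡ 1
ways-noOnes c g0 δ h rewrite ≤ᵇ-true h = refl
ways-noOnes c g1 δ h rewrite ≤ᵇ-true h = refl
ways-noOnes c g2 δ h rewrite ≤ᵇ-true h = refl

words≡ways : ∀ c s m k δ → c ≤ 2 → δ ≤ 2 → gap s + δ + m ≡ k * 3 + c → words c s m k ≡ ways c s δ k
words≡ways c s m zero δ c≤2 δ≤2 e =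
  trans (words-noOnes c s m c≤2 (≤-trans (+-monoˡ-≤ m (m≤m+n (gap s) δ)) (≤-reflexive e)))
        (sym (ways-noOnes c s δ (≤-trans (m≤m+n (gap s + δ) m) (≤-reflexive e))))
words≡ways c s m k (suc (suc (suc δ))) c≤2 (s≤s (s≤s ())) e
words≡ways c  g0 zero (suc k) 0 c≤2 δ≤2 ()
words≡ways c  g0 zero (suc k) 1 c≤2 δ≤2 ()
words≡ways c  g0 zero (suc k) 2 c≤2 δ≤2 ()
words≡ways c  g1 zero (suc k) 0 c≤2 δ≤2 ()
words≡ways c  g1 zero (suc k) 1 c≤2 δ≤2 ()
words≡ways .0 g1 zero 1       2 c≤2 δ≤2 refl = refl
words≡ways c  g1 zero (suc (suc k)) 2 c≤2 δ≤2 ()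
words≡ways c  g2 zero (suc k) 0 c≤2 δ≤2 ()
words≡ways .0 g2 zero 1       1 c≤2 δ≤2 refl = refl
words≡ways c  g2 zero (suc (suc k)) 1 c≤2 δ≤2 ()
words≡ways .1 g2 zero 1       2 c≤2 δ≤2 refl = refl
words≡ways c  g2 zero (suc (suc k)) 2 c≤2 δ≤2 ()
words≡ways c g0 (suc .(suc (suc (k * 3 + c)))) (suc k) 0 c≤2 δ≤2 refl =
  cong₂ _+_ (words-overlong c g0 _ k (s≤s (n≤1+n _))) (words≡ways c g1 _ (suc k) 0 c≤2 δ≤2 refl)
words≡ways c g0 (suc .(suc (k * 3 + c))) (suc k) 1 c≤2 δ≤2 refl =
  cong₂ _+_ (words-overlong c g0 _ k ≤-refl) (words≡ways c g1 _ (suc k) 1 c≤2 δ≤2 refl)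
words≡ways c g0 (suc .(k * 3 + c)) (suc k) 2 c≤2 δ≤2 refl =
  cong₂ _+_ (words≡ways c g0 _ k 0 c≤2 z≤n refl) (words≡ways c g1 _ (suc k) 2 c≤2 δ≤2 refl)
words≡ways c g1 (suc .(suc (k * 3 + c))) (suc k) 0 c≤2 δ≤2 refl =
  cong₂ _+_ (words-overlong c g0 _ k ≤-refl) (words≡ways c g2 _ (suc k) 0 c≤2 δ≤2 refl)
words≡ways c g1 (suc .(k * 3 + c)) (suc k) 1 c≤2 δ≤2 refl =
  cong₂ _+_ (words≡ways c g0 _ k 0 c≤2 z≤n refl) (words≡ways c g2 _ (suc k) 1 c≤2 δ≤2 refl)
words≡ways c g1 (suc m) (suc k) 2 c≤2 δ≤2 e =
  cong₂ _+_ (words≡ways c g0 m k 1 c≤2 (s≤s z≤n) (+-cancelˡ-≡ 3 _ _ e))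
            (words≡ways c g2 m (suc k) 2 c≤2 δ≤2 e)
words≡ways c g2 (suc m) (suc k) δ c≤2 δ≤2 e =
  trans (cong₂ _+_ (words≡ways c g0 m k δ c≤2 δ≤2 (+-cancelˡ-≡ 3 _ _ (trans (sym (+-suc (2 + δ) m)) e)))
                   (count-∧-false m _))
        (+-identityʳ _)

suc-C-2 : ∀ k → suc k C 2 ≡ k + k C 2
suc-C-2 k = trans (sym (nCk+nC[k+1]≡[n+1]C[k+1] k 1)) (cong (_+ k C 2) (nC1≡n k))

3+-C-2 : ∀ j → (3 + j) C 2 ≡ 2 + j + (1 + j + (j + j C 2))
3+-C-2 j = trans (suc-C-2 (2 + j)) (cong (2 + j +_) (trans (suc-C-2 (1 + j)) (cong (1 + j +_) (suc-C-2 j))))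

ways₀-tight : ∀ c k → ways₀ c 0 k ≡ 1
ways₀-tight c zero    = refl
ways₀-tight c (suc k) = ways₀-tight c k

ways₀-slack₁ : ∀ c k → ways₀ c 1 k ≡ k + ways₀ c 1 0
ways₀-slack₁ c zero    = refl
ways₀-slack₁ c (suc k) = cong₂ _+_ (ways₀-tight c k) (ways₀-slack₁ c k)

ways₀-slack₂ : ∀ c k → ways₀ c 2 k ≡ ways₀ c 2 0 + k * (1 + ways₀ c 1 0) + k C 2
ways₀-slack₂ c zero    = sym (trans (+-identityʳ _) (+-identityʳ _))
ways₀-slack₂ c (suc k) = begin
    ways₀ c 0 k + (ways₀ c 1 k + ways₀ c 2 k)
  ≡⟨ cong₂ _+_ (ways₀-tight c k) (cong₂ _+_ (ways₀-slack₁ c k) (ways₀-slack₂ c k)) ⟩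
    1 + (k + a + (b + k * (1 + a) + k C 2))
  ≡⟨ regroup k a b (k C 2) ⟩
    b + suc k * (1 + a) + (k + k C 2)
  ≡⟨ cong (b + suc k * (1 + a) +_) (suc-C-2 k) ⟨
    b + suc k * (1 + a) + suc k C 2 ∎
  where
  open ≡-Reasoning
  a = ways₀ c 1 0
  b = ways₀ c 2 0
  regroup : ∀ k a b x → 1 + (k + a + (b + k * (1 + a) + x)) ≡ b + suc k * (1 + a) + (k + x)
  regroup = solve-∀

-- Positions past the end read as members, so a window overhanging the end imposes nothing.
bitAt : List Bool → ℕ → Bool
bitAt []      _       = true
bitAt (x ∷ w) zero    = x
bitAt (x ∷ w) (suc i) = bitAt w i

window : List Bool → ℕ → Bool
window w i = bitAt w i ∨ bitAt w (1 + i) ∨ bitAt w (2 + i)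

allWindows : List Bool → Bool
allWindows []      = true
allWindows (x ∷ w) = window (x ∷ w) 0 ∧ allWindows w

run≡allWindows : ∀ s w → run s w ≡ allWindows (replicate (gap s) false ++ w)
run≡allWindows g0 []          = refl
run≡allWindows g1 []          = refl
run≡allWindows g2 []          = refl
run≡allWindows g0 (true ∷ w)  = run≡allWindows g0 w
run≡allWindows g1 (true ∷ w)  = run≡allWindows g0 w
run≡allWindows g2 (true ∷ w)  = run≡allWindows g0 w
run≡allWindows g0 (false ∷ w) = run≡allWindows g1 w
run≡allWindows g1 (false ∷ w) = run≡allWindows g2 w
run≡allWindows g2 (false ∷ w) = refl

allWindows-sound : ∀ w → T (allWindows w) → ∀ i → T (window w i)
allWindows-sound []      _ i       = _
allWindows-sound (x ∷ w) h zero    = proj₁ (Equivalence.to T-∧ h)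
allWindows-sound (x ∷ w) h (suc i) = allWindows-sound w (proj₂ (Equivalence.to T-∧ h)) i

allWindows-complete : ∀ w → (∀ i → T (window w i)) → T (allWindows w)
allWindows-complete []      _ = _
allWindows-complete (x ∷ w) h = Equivalence.from T-∧ (h 0 , allWindows-complete w (h ∘ suc))

bitAt-++ˡ : ∀ {n} (D : Vec Bool n) e {p} (p<n : p < n) → bitAt (toList D ++ e) p ≡ lookup D (fromℕ< p<n)
bitAt-++ˡ (x ∷ D) e {zero}  _   = refl
bitAt-++ˡ (x ∷ D) e {suc p} p<n = bitAt-++ˡ D e (s<s⁻¹ p<n)

bitAt-++ʳ : ∀ {n} (D : Vec Bool n) e q → bitAt (toList D ++ e) (n + q) ≡ bitAt e q
bitAt-++ʳ []      e q = refl
bitAt-++ʳ (x ∷ D) e q = bitAt-++ʳ D e q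

bitAt-beyond : ∀ w {i} → length w ≤ i → bitAt w i ≡ true
bitAt-beyond []      _       = refl
bitAt-beyond (x ∷ w) (s≤s h) = bitAt-beyond w h

T-∨³ : ∀ a b c → T (a ∨ b ∨ c) ⇔ (T a ⊎ T b ⊎ T c)
T-∨³ a b c = mk⇔ (map₂ (Equivalence.to (T-∨ {b})) ∘ Equivalence.to (T-∨ {a}))
                 (Equivalence.from (T-∨ {a}) ∘ map₂ (Equivalence.from (T-∨ {b})))

∈⇒T : ∀ {n} {u : Fin n} {D : Subset n} → u ∈ D → T (lookup D u)
∈⇒T = Equivalence.from T-≡ ∘ []=⇒lookup

T⇒∈ : ∀ {n} {u : Fin n} {D : Subset n} → T (lookup D u) → u ∈ D
T⇒∈ {u = u} {D} = lookup⇒[]= u D ∘ Equivalence.to T-≡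

-- Repeating the first two bits at the end makes every three cyclically consecutive bits a window.
cyclicWord : ∀ {n} → Vec Bool (2 + n) → List Bool
cyclicWord D@(x₀ ∷ x₁ ∷ _) = toList D ++ x₀ ∷ x₁ ∷ []

module CycleOf (m : ℕ) where

  N : ℕ
  N = 3 + m

  next : Fin N → Fin N
  next u = fromℕ< (m%n<n (suc (toℕ u)) N)

  toℕ-next : ∀ u → toℕ (next u) ≡ suc (toℕ u) % N
  toℕ-next u = toℕ-fromℕ< (m%n<n (suc (toℕ u)) N)

  toℕ-next-cases : ∀ u → toℕ (next u) ≡ suc (toℕ u) ⊎ (suc (toℕ u) ≡ N × toℕ (next u) ≡ 0)
  toℕ-next-cases u with m≤n⇒m<n∨m≡n (toℕ<n u)
  ... | inj₁ 1+u<N = inj₁ (trans (toℕ-next u) (m<n⇒m%n≡m 1+u<N))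
  ... | inj₂ 1+u≡N = inj₂ (1+u≡N , trans (toℕ-next u) (trans (cong (_% N) 1+u≡N) (n%n≡0 N)))

  next-injective : ∀ {u v} → next u ≡ next v → u ≡ v
  next-injective {u} {v} eq with toℕ-next-cases u | toℕ-next-cases v
  ... | inj₁ eu       | inj₁ ev       = toℕ-injective (suc-injective (trans (sym eu) (trans (cong toℕ eq) ev)))
  ... | inj₂ (eu , _) | inj₂ (ev , _) = toℕ-injective (suc-injective (trans eu (sym ev)))
  ... | inj₁ eu       | inj₂ (_ , ev) with trans (sym eu) (trans (cong toℕ eq) ev)
  ...   | ()
  next-injective eq | inj₂ (_ , eu) | inj₁ ev with trans (sym ev) (trans (cong toℕ (sym eq)) eu)
  ...   | ()

  next-surjective : ∀ v → ∃ λ u → next u ≡ v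
  next-surjective zero    = fromℕ (2 + m) , toℕ-injective (begin
      toℕ (next (fromℕ (2 + m)))  ≡⟨ toℕ-next (fromℕ (2 + m)) ⟩
      suc (toℕ (fromℕ (2 + m))) % N ≡⟨ cong (λ x → suc x % N) (toℕ-fromℕ (2 + m)) ⟩
      N % N                       ≡⟨ n%n≡0 N ⟩
      0                           ∎)
    where open ≡-Reasoning
  next-surjective (suc v) = inject₁ v , toℕ-injective (begin
      toℕ (next (inject₁ v))     ≡⟨ toℕ-next (inject₁ v) ⟩
      suc (toℕ (inject₁ v)) % N  ≡⟨ cong (λ x → suc x % N) (toℕ-inject₁ v) ⟩
      suc (toℕ v) % N            ≡⟨ m<n⇒m%n≡m (toℕ<n (suc v)) ⟩
      suc (toℕ v)                ∎)
    where open ≡-Reasoning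

  covered : Vec Bool N → Fin N → Bool
  covered D u = lookup D u ∨ lookup D (next u) ∨ lookup D (next (next u))

  T-covered : ∀ D u → T (covered D u) ⇔ (T (lookup D u) ⊎ T (lookup D (next u)) ⊎ T (lookup D (next (next u))))
  T-covered D u = T-∨³ (lookup D u) (lookup D (next u)) (lookup D (next (next u)))

  adjacent-next : ∀ u → CycleAdj m u (next u)
  adjacent-next u = inj₁ (toℕ-next u)

  next-adjacent : ∀ v → CycleAdj m (next v) v
  next-adjacent v = inj₂ (toℕ-next v)

  adjacent-to-next : ∀ {x u} → CycleAdj m x (next u) → x ≡ u ⊎ x ≡ next (next u)
  adjacent-to-next {x} {u} (inj₁ e) = inj₁ (next-injective (sym (toℕ-injective (trans e (sym (toℕ-next x))))))
  adjacent-to-next {x} {u} (inj₂ e) = inj₂ (toℕ-injective (trans e (sym (toℕ-next (next u)))))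

  dominating⇒covered : ∀ D → Dominating (Cycle m) D → ∀ u → T (covered D u)
  dominating⇒covered D dom u with next u ∈? D
  ... | yes next-u∈D = Equivalence.from (T-covered D u) (inj₂ (inj₁ (∈⇒T next-u∈D)))
  ... | no  next-u∉D with dom (next u) next-u∉D
  ...   | x , x∈D , adj with adjacent-to-next {x} {u} adj
  ...     | inj₁ refl = Equivalence.from (T-covered D u) (inj₁ (∈⇒T x∈D))
  ...     | inj₂ refl = Equivalence.from (T-covered D u) (inj₂ (inj₂ (∈⇒T x∈D)))

  covered⇒dominating : ∀ D → (∀ u → T (covered D u)) → Dominating (Cycle m) D
  covered⇒dominating D cov v v∉D with next-surjective v
  ... | u , refl with Equivalence.to (T-covered D u) (cov u)
  ...   | inj₁ u∈D               = u , T⇒∈ u∈D , adjacent-next u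
  ...   | inj₂ (inj₁ next-u∈D)   = ⊥-elim (v∉D (T⇒∈ next-u∈D))
  ...   | inj₂ (inj₂ next²-u∈D)  = next (next u) , T⇒∈ next²-u∈D , next-adjacent (next u)

  lookupMod : Vec Bool N → ℕ → Bool
  lookupMod D p = lookup D (fromℕ< (m%n<n p N))

  lookupMod-% : ∀ D p {q} (q<N : q < N) → p % N ≡ q → lookupMod D p ≡ lookup D (fromℕ< q<N)
  lookupMod-% D p {q} q<N p%N≡q = cong (lookup D) (fromℕ<-cong (p % N) q p%N≡q (m%n<n p N) q<N)

  lookupMod-toℕ : ∀ D u → lookupMod D (toℕ u) ≡ lookup D u
  lookupMod-toℕ D u = trans (lookupMod-% D (toℕ u) (toℕ<n u) (m<n⇒m%n≡m (toℕ<n u))) (cong (lookup D) (fromℕ<-toℕ u (toℕ<n u)))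

  lookupMod-next² : ∀ D u → lookupMod D (2 + toℕ u) ≡ lookup D (next (next u))
  lookupMod-next² D u = cong (lookup D) (fromℕ<-cong ((2 + toℕ u) % N) (suc (toℕ (next u)) % N) (begin
      (2 + toℕ u) % N                  ≡⟨ %-distribˡ-+ 1 (suc (toℕ u)) N ⟩
      (1 % N + suc (toℕ u) % N) % N    ≡⟨ cong (λ x → (1 % N + x) % N) (m%n%n≡m%n (suc (toℕ u)) N) ⟨
      (1 % N + suc (toℕ u) % N % N) % N ≡⟨ %-distribˡ-+ 1 (suc (toℕ u) % N) N ⟨
      suc (suc (toℕ u) % N) % N        ≡⟨ cong (λ x → suc x % N) (toℕ-next u) ⟨
      suc (toℕ (next u)) % N           ∎) (m%n<n (2 + toℕ u) N) (m%n<n (suc (toℕ (next u))) N))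
    where open ≡-Reasoning

  bitAt-cyclicWord : ∀ D {p} → p < 2 + N → bitAt (cyclicWord D) p ≡ lookupMod D p
  bitAt-cyclicWord D@(x₀ ∷ x₁ ∷ _) {p} p<2+N with m≤n⇒m<n∨m≡n (s≤s⁻¹ p<2+N)
  ... | inj₂ refl = begin
      bitAt (cyclicWord D) (suc N)   ≡⟨ cong (bitAt (cyclicWord D)) (+-comm 1 N) ⟩
      bitAt (cyclicWord D) (N + 1)   ≡⟨ bitAt-++ʳ D _ 1 ⟩
      x₁                             ≡⟨ lookupMod-% D (suc N) (s≤s (s≤s z≤n)) ([m+n]%n≡m%n 1 N) ⟨
      lookupMod D (suc N)            ∎
    where open ≡-Reasoning
  ... | inj₁ p<1+N with m≤n⇒m<n∨m≡n (s≤s⁻¹ p<1+N)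
  ...   | inj₁ p<N  = trans (bitAt-++ˡ D _ p<N) (sym (lookupMod-% D p p<N (m<n⇒m%n≡m p<N)))
  ...   | inj₂ refl = begin
      bitAt (cyclicWord D) N         ≡⟨ cong (bitAt (cyclicWord D)) (+-identityʳ N) ⟨
      bitAt (cyclicWord D) (N + 0)   ≡⟨ bitAt-++ʳ D _ 0 ⟩
      x₀                             ≡⟨ lookupMod-% D N (s≤s z≤n) (n%n≡0 N) ⟨
      lookupMod D N                  ∎
    where open ≡-Reasoning

  window-cyclicWord : ∀ D u → window (cyclicWord D) (toℕ u) ≡ covered D u
  window-cyclicWord D u = cong₂ _∨_
    (trans (bitAt-cyclicWord D (≤-trans u<N (m≤n+m N 2))) (lookupMod-toℕ D u))
    (cong₂ _∨_ (bitAt-cyclicWord D (s≤s (≤-trans u<N (m≤n+m N 1))))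
               (trans (bitAt-cyclicWord D (s≤s (s≤s u<N))) (lookupMod-next² D u)))
    where u<N = toℕ<n u

  length-cyclicWord : (D : Vec Bool N) → length (cyclicWord D) ≡ 2 + N
  length-cyclicWord D@(_ ∷ _ ∷ _) = trans (length-++ (toList D)) (trans (cong (_+ 2) (length-toList D)) (+-comm N 2))

  window-cyclicWord-beyond : (D : Vec Bool N) {i : ℕ} → N ≤ i → T (window (cyclicWord D) i)
  window-cyclicWord-beyond D {i} N≤i =
    Equivalence.from (T-∨³ (bitAt w i) (bitAt w (1 + i)) (bitAt w (2 + i)))
                     (inj₂ (inj₂ (Equivalence.from T-≡ last≡true)))
    where
    w = cyclicWord D
    last≡true : bitAt w (2 + i) ≡ true
    last≡true = bitAt-beyond w (≤-trans (≤-reflexive (length-cyclicWord D)) (+-monoʳ-≤ 2 N≤i))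

  run-cyclicWord⇔covered : ∀ D → T (run g0 (cyclicWord D)) ⇔ (∀ u → T (covered D u))
  run-cyclicWord⇔covered D = mk⇔
    (λ h u → subst T (window-cyclicWord D u) (allWindows-sound w (subst T (run≡allWindows g0 w) h) (toℕ u)))
    (λ h → subst T (sym (run≡allWindows g0 w)) (allWindows-complete w (allCovered h)))
    where
    w = cyclicWord D
    allCovered : (∀ u → T (covered D u)) → ∀ i → T (window w i)
    allCovered h i with i <? N
    ... | yes i<N = subst (T ∘ window w) (toℕ-fromℕ< i<N)
                          (subst T (sym (window-cyclicWord D (fromℕ< i<N))) (h (fromℕ< i<N)))
    ... | no  i≮N = window-cyclicWord-beyond D (≮⇒≥ i≮N)

  dominating?≡run-cyclicWord : ∀ D → does (dominating? (Cycle m) D) ≡ run g0 (cyclicWord D)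
  dominating?≡run-cyclicWord D = det (Dec.proof (dominating? (Cycle m) D)) (fromEquivalence
    (covered⇒dominating D ∘ Equivalence.to (run-cyclicWord⇔covered D))
    (Equivalence.from (run-cyclicWord⇔covered D) ∘ dominating⇒covered D))

tolerates-11 : Tolerates (true ∷ true ∷ []) 2
tolerates-11 = λ { g0 → refl ; g1 → refl ; g2 → refl }

tolerates-10 : Tolerates (true ∷ false ∷ []) 2
tolerates-10 = λ { g0 → refl ; g1 → refl ; g2 → refl }

tolerates-01 : Tolerates (false ∷ true ∷ []) 1
tolerates-01 = λ { g0 → refl ; g1 → refl ; g2 → refl }

tolerates-00 : Tolerates (false ∷ false ∷ []) 0
tolerates-00 = λ { g0 → refl ; g1 → refl ; g2 → refl }

γ-cycle : ∀ m k → γ (Cycle m) k ≡ count (3 + m) (λ D → (∣ D ∣ ≡ᵇ k) ∧ run g0 (cyclicWord D))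
γ-cycle m k = trans
  (length-filter-allSubsets (3 + m) (λ D → (∣ D ∣ ≟ k) ×-dec dominating? (Cycle m) D))
  (count-cong (3 + m) (λ D → cong ((∣ D ∣ ≡ᵇ k) ∧_) (CycleOf.dominating?≡run-cyclicWord m D)))

-- Split by the first two bits 11, 10, 01, 00; repeated at the end, they bound the final run.
γ-cycle-split : ∀ m k → γ (Cycle m) (2 + k) ≡
  (words 2 g0 (1 + m) k + words 2 g1 (1 + m) (1 + k)) + (words 1 g0 (1 + m) (1 + k) + words 0 g2 (1 + m) (2 + k))
γ-cycle-split m k = trans (γ-cycle m (2 + k))
  (cong₂ _+_ (cong₂ _+_ (closeWith tolerates-11 g0) (closeWith tolerates-10 g1))
             (cong₂ _+_ (closeWith tolerates-01 g0) (closeWith tolerates-00 g2)))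
  where
  closeWith : ∀ {t c k'} → Tolerates t c → ∀ s →
              count (1 + m) (λ r → (∣ r ∣ ≡ᵇ k') ∧ run s (toList r ++ t)) ≡ words c s (1 + m) k'
  closeWith {t} {c} {k'} tol s =
    count-cong (1 + m) (λ r → cong ((∣ r ∣ ≡ᵇ k') ∧_) (run-++-tolerant {t} {c} tol s r))

-- The first piece has slack δ - 2, negative unless δ = 2, so it stays a word count.
γ-cycle-slack : ∀ m k δ → δ ≤ 2 → m + δ ≡ k * 3 + 3 → γ (Cycle m) (2 + k) ≡
  (words 2 g0 (1 + m) k + ways₁ 2 δ (1 + k)) + (ways₀ 1 δ (1 + k) + ways₂ 0 δ (2 + k))
γ-cycle-slack m k δ δ≤2 slack = trans (γ-cycle-split m k) (cong₂ _+_
  (cong (words 2 g0 (1 + m) k +_) (words≡ways 2 g1 (1 + m) (1 + k) δ ≤-refl δ≤2 (fromSlack 1 (shift₁ k))))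
  (cong₂ _+_ (words≡ways 1 g0 (1 + m) (1 + k) δ (s≤s z≤n) δ≤2 (fromSlack 0 (shift₀ k)))
             (words≡ways 0 g2 (1 + m) (2 + k) δ z≤n δ≤2 (fromSlack 2 (shift₂ k)))))
  where
  regroup : ∀ g δ m → g + δ + (1 + m) ≡ m + δ + (1 + g)
  regroup = solve-∀
  fromSlack : ∀ g {r} → k * 3 + 3 + (1 + g) ≡ r → g + δ + (1 + m) ≡ r
  fromSlack g eq = trans (regroup g δ m) (trans (cong (_+ (1 + g)) slack) eq)
  shift₀ : ∀ k → k * 3 + 3 + 1 ≡ suc k * 3 + 1
  shift₀ = solve-∀
  shift₁ : ∀ k → k * 3 + 3 + 2 ≡ suc k * 3 + 2
  shift₁ = solve-∀
  shift₂ : ∀ k → k * 3 + 3 + 3 ≡ suc (suc k) * 3 + 0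
  shift₂ = solve-∀

γ-cycle-3k : ∀ j → γ (Cycle (3 * j)) (suc j) ≡ 3
γ-cycle-3k zero    = refl  -- γ-cycle-slack needs two members; C_3 is evaluated
γ-cycle-3k (suc i) = begin
    γ (Cycle (3 * suc i)) (2 + i)
  ≡⟨ γ-cycle-slack (3 * suc i) i 0 z≤n (slack i) ⟩
    (words 2 g0 (1 + 3 * suc i) i + ways₁ 2 0 (1 + i)) + (ways₀ 1 0 (1 + i) + ways₂ 0 0 (2 + i))
  ≡⟨ cong₂ _+_ (cong₂ _+_ (words-overlong 2 g0 (1 + 3 * suc i) i (overlong i)) (ways₀-tight 2 i))
               (cong₂ _+_ (ways₀-tight 1 (1 + i)) (ways₀-tight 0 (1 + i))) ⟩
    3 ∎
  where
  open ≡-Reasoning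
  slack : ∀ i → 3 * suc i + 0 ≡ i * 3 + 3
  slack = solve-∀
  overlong : ∀ i → i * 3 + 2 < 1 + 3 * suc i
  overlong i = ≤-trans (n≤1+n _) (≤-reflexive (excess i))
    where
    excess : ∀ i → 2 + (i * 3 + 2) ≡ 1 + 3 * suc i
    excess = solve-∀

γ-cycle-3k+1 : ∀ j → γ (Cycle (1 + 3 * j)) (2 + j) ≡ (suc j + 2) C 2 + 2 * (suc j C 2) + 3 * suc j
γ-cycle-3k+1 j = begin
    γ (Cycle (1 + 3 * j)) (2 + j)
  ≡⟨ γ-cycle-slack (1 + 3 * j) j 2 ≤-refl (slack j) ⟩
    (words 2 g0 (2 + 3 * j) j + ways₁ 2 2 (1 + j)) + (ways₀ 1 2 (1 + j) + ways₂ 0 2 (2 + j))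
  ≡⟨ cong₂ _+_
       (cong₂ _+_ (trans (words≡ways 2 g0 (2 + 3 * j) j 0 ≤-refl z≤n (tight j)) (ways₀-tight 2 j))
                  (cong₂ _+_ (ways₀-slack₁ 2 j) (ways₀-slack₂ 2 j)))
       (cong₂ _+_ (ways₀-slack₂ 1 (1 + j)) (ways₀-slack₂ 0 (1 + j))) ⟩
    1 + (j + 1 + (1 + j * 2 + x)) + ((0 + suc j * 2 + suc j C 2) + (0 + suc j * 1 + suc j C 2))
  ≡⟨ cong (λ y → 1 + (j + 1 + (1 + j * 2 + x)) + ((0 + suc j * 2 + y) + (0 + suc j * 1 + y))) (suc-C-2 j) ⟩
    1 + (j + 1 + (1 + j * 2 + x)) + ((0 + suc j * 2 + (j + x)) + (0 + suc j * 1 + (j + x)))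
  ≡⟨ regroup j x ⟩
    2 + j + (1 + j + (j + x)) + 2 * (j + x) + 3 * suc j
  ≡⟨ cong₂ (λ a b → a + 2 * b + 3 * suc j) (3+-C-2 j) (suc-C-2 j) ⟨
    (3 + j) C 2 + 2 * (suc j C 2) + 3 * suc j
  ≡⟨ cong (λ n → n C 2 + 2 * (suc j C 2) + 3 * suc j) (+-comm 2 (suc j)) ⟩
    (suc j + 2) C 2 + 2 * (suc j C 2) + 3 * suc j ∎
  where
  open ≡-Reasoning
  x = j C 2
  slack : ∀ j → 1 + 3 * j + 2 ≡ j * 3 + 3
  slack = solve-∀
  tight : ∀ j → 0 + 0 + (2 + 3 * j) ≡ j * 3 + 2
  tight = solve-∀
  regroup : ∀ j x → 1 + (j + 1 + (1 + j * 2 + x)) + ((0 + suc j * 2 + (j + x)) + (0 + suc j * 1 + (j + x)))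
                  ≡ 2 + j + (1 + j + (j + x)) + 2 * (j + x) + 3 * suc j
  regroup = solve-∀

γ-cycle-3k+2 : ∀ j → γ (Cycle (2 + 3 * j)) (2 + j) ≡ 3 * suc j + 2
γ-cycle-3k+2 j = begin
    γ (Cycle (2 + 3 * j)) (2 + j)
  ≡⟨ γ-cycle-slack (2 + 3 * j) j 1 (s≤s z≤n) (slack j) ⟩
    (words 2 g0 (3 + 3 * j) j + ways₁ 2 1 (1 + j)) + (ways₀ 1 1 (1 + j) + ways₂ 0 1 (2 + j))
  ≡⟨ cong₂ _+_
       (cong₂ _+_ (words-overlong 2 g0 (3 + 3 * j) j (overlong j))
                  (cong₂ _+_ (ways₀-tight 2 j) (ways₀-slack₁ 2 j)))
       (cong₂ _+_ (ways₀-slack₁ 1 (1 + j)) (ways₀-slack₁ 0 (1 + j))) ⟩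
    0 + (1 + (j + 1)) + ((suc j + 1) + (suc j + 0))
  ≡⟨ regroup j ⟩
    3 * suc j + 2 ∎
  where
  open ≡-Reasoning
  slack : ∀ j → 2 + 3 * j + 1 ≡ j * 3 + 3
  slack = solve-∀
  overlong : ∀ j → j * 3 + 2 < 3 + 3 * j
  overlong j = ≤-reflexive (excess j)
    where
    excess : ∀ j → suc (j * 3 + 2) ≡ 3 + 3 * j
    excess = solve-∀
  regroup : ∀ j → 0 + (1 + (j + 1)) + ((suc j + 1) + (suc j + 0)) ≡ 3 * suc j + 2
  regroup = solve-∀

mainTheorem10 : (j : ℕ) → let k = suc j in
    (γ (Cycle (3 * j)) k ≡ 3)
    × (γ (Cycle (1 + 3 * j)) (suc k) ≡ ((k + 2) C 2) + 2 * (k C 2) + 3 * k)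
    × (γ (Cycle (2 + 3 * j)) (suc k) ≡ 3 * k + 2)
mainTheorem10 j = γ-cycle-3k j , γ-cycle-3k+1 j , γ-cycle-3k+2 j
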